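{- Let $\mathcal A$ be a finite category and let $\zeta(a,b)=|\operatorname{Hom}(a,b)|$ for $a,b\in\operatorname{Ob}\mathcal A$. Suppose the matrix $\zeta$ is invertible, with inverse $\mu=\zeta^{ -1}$. Then for all $a,b\in\operatorname{Ob}\mathcal A$, if $\zeta(a,b)=0$ then $\mu(a,b)=0$.
   Context: $\zeta$ is viewed as a square rational matrix with rows and columns indexed by $\operatorname{Ob}\mathcal A$, with product $(\theta\phi)(a,c)=\sum_b\theta(a,b)\phi(b,c)$ and identity the Kronecker delta; $\mu$ is its two-sided inverse (the Möbius function). -}

module Defs where

open import Data.Nat using (ℕ; zero; suc)
open import Data.Fin using (Fin; zero; suc)
open import Data.Integer using (+_)
open import Data.Rational using (ℚ; 0ℚ; 1ℚ; _+_; _*_; _/_)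
open import Relation.Binary.PropositionalEquality using (_≡_)
open import Data.Product using (_×_)

-- A finite category: finitely many objects (indexed by Fin nObj), and for
-- each pair of objects a finite hom-set, represented (up to bijection) as
-- Fin (hom a b).
record FiniteCategory : Set where
  field
    nObj : ℕ
    hom  : Fin nObj → Fin nObj → ℕ
    idm  : (a : Fin nObj) → Fin (hom a a)
    _∘_  : ∀ {a b c} → Fin (hom b c) → Fin (hom a b) → Fin (hom a c)
    assoc : ∀ {a b c d} (h : Fin (hom c d)) (g : Fin (hom b c)) (f : Fin (hom a b)) →
            (h ∘ g) ∘ f ≡ h ∘ (g ∘ f)
    identityˡ : ∀ {a b} (f : Fin (hom a b)) → idm b ∘ f ≡ f
    identityʳ : ∀ {a b} (f : Fin (hom a b)) → f ∘ idm a ≡ f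

Matrix : ℕ → Set
Matrix n = Fin n → Fin n → ℚ

sumFin : ∀ {n} → (Fin n → ℚ) → ℚ
sumFin {zero}  f = 0ℚ
sumFin {suc n} f = f zero + sumFin (λ i → f (suc i))

_⊗_ : ∀ {n} → Matrix n → Matrix n → Matrix n
(θ ⊗ φ) a c = sumFin (λ b → θ a b * φ b c)

δ : ∀ {n} → Matrix n
δ zero    zero    = 1ℚ
δ zero    (suc j) = 0ℚ
δ (suc i) zero    = 0ℚ
δ (suc i) (suc j) = δ i j

ℕ→ℚ : ℕ → ℚ
ℕ→ℚ k = + k / 1

ζ : (𝒜 : FiniteCategory) → Matrix (FiniteCategory.nObj 𝒜)
ζ 𝒜 a b = ℕ→ℚ (FiniteCategory.hom 𝒜 a b)

IsInverse : ∀ {n} → Matrix n → Matrix n → Set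
IsInverse θ μ = (∀ a c → (θ ⊗ μ) a c ≡ δ a c) × (∀ a c → (μ ⊗ θ) a c ≡ δ a c)

-- Let U be the set of objects admitting a morphism to b. Composition shows that
-- ζ(x, y) = 0 whenever x ∉ U and y ∈ U, so ζ is block triangular for the
-- partition (U, complement of U), and the inverse of a block-triangular matrix
-- is block triangular with the same zero block; a ∉ U and b ∈ U give μ(a, b) = 0.
-- The only linear algebra needed is that a right inverse of a square matrix is
-- also a left inverse, which follows from Gaussian elimination: a homogeneous
-- system with more unknowns than equations has a nonzero solution.
module Submission where

open import Defs
open import Data.Nat using (zero; suc)
import Data.Nat as ℕ
open import Data.Fin using (Fin; zero; suc; punchIn)
open import Data.Fin.Properties using (all?; ¬∀⟶∃¬; ¬Fin0)
import Data.Integer as ℤ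
open import Data.Integer.Properties using (+-injective)
open import Data.Integer.GCD using (gcd)
open import Data.Rational using (ℚ; 0ℚ; 1ℚ; _+_; _*_; -_; 1/_; ↥_; ≢-nonZero)
open import Data.Rational.Properties
open import Data.Vec.Functional using (Vector; _∷_; insertAt; removeAt)
open import Data.Vec.Functional.Properties using (insertAt-lookup; insertAt-punchIn)
open import Data.Product using (_,_; ∃-syntax; _×_)
open import Data.Empty using (⊥-elim)
open import Function using (_∘_; case_of_)
open import Level using (0ℓ)
open import Relation.Binary.PropositionalEquality
  using (_≡_; _≢_; _≗_; refl; sym; trans; cong; cong₂; subst; module ≡-Reasoning)
open import Relation.Nullary using (¬_; Dec; yes; no)
open import Relation.Unary using (Pred; Decidable)
open import Algebra.Bundles using (Ring; CommutativeMonoid)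
open import Algebra.Properties.Semiring.Sum (Ring.semiring +-*-ring)
  using (sum; sum-cong-≗; sum-replicate-zero; ∑-comm; ∑-distrib-+; *-distribˡ-sum; *-distribʳ-sum; sum-remove)
open import Algebra.Properties.CommutativeSemigroup (CommutativeMonoid.commutativeSemigroup *-1-commutativeMonoid)
  using (x∙yz≈y∙xz)
open import Algebra.Properties.Group +-0-group using (inverseʳ-unique; x∙y⁻¹≈ε⇒x≈y)
open import Algebra.Properties.Ring +-*-ring using (-1*x≈-x)

open ≡-Reasoning

sum-zero : ∀ {n} {f : Vector ℚ n} → (∀ i → f i ≡ 0ℚ) → sum f ≡ 0ℚ
sum-zero {n} f≗0 = trans (sum-cong-≗ f≗0) (sum-replicate-zero n)

sumFin≡sum : ∀ {n} (f : Vector ℚ n) → sumFin f ≡ sum f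
sumFin≡sum {zero}  f = refl
sumFin≡sum {suc n} f = cong (f zero +_) (sumFin≡sum (f ∘ suc))

p*q≡0⇒p≡0 : ∀ {p q} → q ≢ 0ℚ → p * q ≡ 0ℚ → p ≡ 0ℚ
p*q≡0⇒p≡0 {p} {q} q≢0 pq≡0 = begin
  p                 ≡⟨ sym (*-identityʳ p) ⟩
  p * 1ℚ            ≡⟨ cong (p *_) (sym (*-inverseʳ q {{≢-nonZero q≢0}})) ⟩
  p * (q * q⁻¹)     ≡⟨ sym (*-assoc p q q⁻¹) ⟩
  p * q * q⁻¹       ≡⟨ cong (_* q⁻¹) pq≡0 ⟩
  0ℚ * q⁻¹          ≡⟨ *-zeroˡ q⁻¹ ⟩
  0ℚ                ∎
  where q⁻¹ = 1/_ q {{≢-nonZero q≢0}}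

infix 7 _∙_
infixr 7 _·_

_∙_ : ∀ {n} → Vector ℚ n → Vector ℚ n → ℚ
u ∙ v = sum (λ j → u j * v j)

_·_ : ∀ {m n} → (Fin m → Vector ℚ n) → Vector ℚ n → Vector ℚ m
(M · v) i = M i ∙ v

_ᵀ : ∀ {n} → Matrix n → Matrix n
(M ᵀ) i j = M j i

⊗-∙ : ∀ {n} (A B : Matrix n) i j → (A ⊗ B) i j ≡ A i ∙ (B ᵀ) j
⊗-∙ A B i j = sumFin≡sum (λ k → A i k * B k j)

∙-congˡ : ∀ {n} {u u′ : Vector ℚ n} (v : Vector ℚ n) → u ≗ u′ → u ∙ v ≡ u′ ∙ v
∙-congˡ v u≗u′ = sum-cong-≗ (λ j → cong (_* v j) (u≗u′ j))

∙-congʳ : ∀ {n} (u : Vector ℚ n) {v v′ : Vector ℚ n} → v ≗ v′ → u ∙ v ≡ u ∙ v′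
∙-congʳ u v≗v′ = sum-cong-≗ (λ j → cong (u j *_) (v≗v′ j))

∙-comm : ∀ {n} (u v : Vector ℚ n) → u ∙ v ≡ v ∙ u
∙-comm u v = sum-cong-≗ (λ j → *-comm (u j) (v j))

∙-distribˡ-+ : ∀ {n} (u v w : Vector ℚ n) → u ∙ (λ j → v j + w j) ≡ u ∙ v + u ∙ w
∙-distribˡ-+ u v w =
  trans (sum-cong-≗ (λ j → *-distribˡ-+ (u j) (v j) (w j))) (∑-distrib-+ (λ j → u j * v j) (λ j → u j * w j))

∙-scaleʳ : ∀ {n} (u v : Vector ℚ n) k → u ∙ (λ j → k * v j) ≡ k * (u ∙ v)
∙-scaleʳ u v k =
  trans (sum-cong-≗ (λ j → x∙yz≈y∙xz (u j) k (v j))) (sym (*-distribˡ-sum k (λ j → u j * v j)))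

∙-negʳ : ∀ {n} (u v : Vector ℚ n) → u ∙ (λ j → - v j) ≡ - (u ∙ v)
∙-negʳ u v = begin
  u ∙ (λ j → - v j)        ≡⟨ ∙-congʳ u (λ j → sym (-1*x≈-x (v j))) ⟩
  u ∙ (λ j → - 1ℚ * v j)   ≡⟨ ∙-scaleʳ u v (- 1ℚ) ⟩
  - 1ℚ * (u ∙ v)           ≡⟨ -1*x≈-x (u ∙ v) ⟩
  - (u ∙ v)                ∎

∙-combinationˡ : ∀ {n} (u w v : Vector ℚ n) k → (λ j → u j + k * w j) ∙ v ≡ u ∙ v + k * (w ∙ v)
∙-combinationˡ u w v k = begin
  (λ j → u j + k * w j) ∙ v    ≡⟨ ∙-comm _ v ⟩
  v ∙ (λ j → u j + k * w j)    ≡⟨ ∙-distribˡ-+ v u _ ⟩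
  v ∙ u + v ∙ (λ j → k * w j)  ≡⟨ cong₂ _+_ (∙-comm v u) (∙-scaleʳ v w k) ⟩
  u ∙ v + k * (v ∙ w)          ≡⟨ cong (λ t → u ∙ v + k * t) (∙-comm v w) ⟩
  u ∙ v + k * (w ∙ v)          ∎

∙-insertAt : ∀ {n} (u : Vector ℚ (suc n)) (v : Vector ℚ n) p y →
             u ∙ insertAt v p y ≡ u p * y + removeAt u p ∙ v
∙-insertAt u v p y = trans (sum-remove {i = p} (λ j → u j * insertAt v p y j))
  (cong₂ _+_ (cong (u p *_) (insertAt-lookup v p y))
             (∙-congʳ (removeAt u p) (insertAt-punchIn v p y)))

·-adjoint : ∀ {n} (u : Vector ℚ n) (B : Matrix n) v → u ∙ (B · v) ≡ ((B ᵀ) · u) ∙ v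
·-adjoint u B v = begin
  sum (λ i → u i * sum (λ j → B i j * v j))    ≡⟨ sum-cong-≗ (λ i → *-distribˡ-sum (u i) (λ j → B i j * v j)) ⟩
  sum (λ i → sum (λ j → u i * (B i j * v j)))  ≡⟨ ∑-comm (λ i j → u i * (B i j * v j)) ⟩
  sum (λ j → sum (λ i → u i * (B i j * v j)))  ≡⟨ sum-cong-≗ column ⟩
  sum (λ j → ((B ᵀ) · u) j * v j)              ∎
  where
  column : ∀ j → sum (λ i → u i * (B i j * v j)) ≡ ((B ᵀ) · u) j * v j
  column j = trans (sum-cong-≗ (λ i → trans (x∙yz≈y∙xz (u i) (B i j) (v j)) (sym (*-assoc (B i j) (u i) (v j)))))
                   (sym (*-distribʳ-sum (v j) (λ i → B i j * u i)))

∙-·-⊗ : ∀ {n} (A B : Matrix n) i v → A i ∙ (B · v) ≡ (A ⊗ B) i ∙ v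
∙-·-⊗ A B i v = trans (·-adjoint (A i) B v)
  (∙-congˡ v (λ k → trans (∙-comm ((B ᵀ) k) (A i)) (sym (⊗-∙ A B i k))))

δ-∙ : ∀ {n} (i : Fin n) (v : Vector ℚ n) → δ i ∙ v ≡ v i
δ-∙ zero v = trans
  (cong₂ _+_ (*-identityˡ (v zero)) (sum-zero (λ j → *-zeroˡ (v (suc j)))))
  (+-identityʳ (v zero))
δ-∙ (suc i) v = trans (cong₂ _+_ (*-zeroˡ (v zero)) (δ-∙ i (v ∘ suc))) (+-identityˡ (v (suc i)))

δ-sym : ∀ {n} (i j : Fin n) → δ i j ≡ δ j i
δ-sym zero    zero    = refl
δ-sym zero    (suc j) = refl
δ-sym (suc i) zero    = refl
δ-sym (suc i) (suc j) = δ-sym i j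

∙-δ : ∀ {n} (u : Vector ℚ n) j → u ∙ (δ ᵀ) j ≡ u j
∙-δ u j = trans (∙-comm u _) (trans (∙-congˡ u (λ k → δ-sym k j)) (δ-∙ j u))

δ-≢ : ∀ {n} (i j : Fin n) → i ≢ j → δ i j ≡ 0ℚ
δ-≢ zero    zero    i≢j = ⊥-elim (i≢j refl)
δ-≢ zero    (suc j) i≢j = refl
δ-≢ (suc i) zero    i≢j = refl
δ-≢ (suc i) (suc j) i≢j = δ-≢ i j (i≢j ∘ cong suc)

NontrivialKernel : ∀ {m n} → (Fin m → Vector ℚ n) → Set
NontrivialKernel M = ∃[ x ] (∃[ j ] x j ≢ 0ℚ) × (∀ i → (M · x) i ≡ 0ℚ)

nontrivialKernel-zero-firstRow : ∀ {m n} (M : Fin (suc m) → Vector ℚ (suc n)) →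
  (∀ j → M zero j ≡ 0ℚ) → NontrivialKernel (λ i j → M (suc i) (suc j)) → NontrivialKernel M
nontrivialKernel-zero-firstRow M row₀≡0 (x , (j , xj≢0) , Mx≡0) = (0ℚ ∷ x) , (suc j , xj≢0) , solves
  where
  solves : ∀ i → (M · (0ℚ ∷ x)) i ≡ 0ℚ
  solves zero    = sum-zero (λ k → trans (cong (_* (0ℚ ∷ x) k) (row₀≡0 k)) (*-zeroˡ ((0ℚ ∷ x) k)))
  solves (suc i) = trans (cong₂ _+_ (*-zeroʳ (M (suc i) zero)) (Mx≡0 i)) (+-identityˡ 0ℚ)

-- One step of Gaussian elimination with pivot M 0 p: clear column p from the
-- other rows using row 0, then delete row 0 and column p.
module Elimination {m n} (M : Fin (suc m) → Vector ℚ (suc n)) (p : Fin (suc n))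
                   (pivot≢0 : M zero p ≢ 0ℚ) where

  pivot⁻¹ : ℚ
  pivot⁻¹ = 1/_ (M zero p) {{≢-nonZero pivot≢0}}

  multiplier : Fin m → ℚ
  multiplier i = - (M (suc i) p * pivot⁻¹)

  reduced : Fin m → Vector ℚ n
  reduced i = removeAt (λ j → M (suc i) j + multiplier i * M zero j) p

  nontrivialKernel-lift : NontrivialKernel reduced → NontrivialKernel M
  nontrivialKernel-lift (x , (j , xj≢0) , reduced·x≡0) =
    x′ , (punchIn p j , subst (_≢ 0ℚ) (sym (insertAt-punchIn x p y j)) xj≢0) , solves
    where
    s y : ℚ
    s = removeAt (M zero) p ∙ x
    y = - (pivot⁻¹ * s)
    x′ : Vector ℚ (suc n)
    x′ = insertAt x p y

    pivot-term : ∀ i → M i p * y ≡ - (M i p * pivot⁻¹) * s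
    pivot-term i = begin
      M i p * - (pivot⁻¹ * s)    ≡⟨ sym (neg-distribʳ-* (M i p) (pivot⁻¹ * s)) ⟩
      - (M i p * (pivot⁻¹ * s))  ≡⟨ cong -_ (sym (*-assoc (M i p) pivot⁻¹ s)) ⟩
      - (M i p * pivot⁻¹ * s)    ≡⟨ neg-distribˡ-* (M i p * pivot⁻¹) s ⟩
      - (M i p * pivot⁻¹) * s    ∎

    solves : ∀ i → (M · x′) i ≡ 0ℚ
    solves zero = begin
      M zero ∙ x′                         ≡⟨ ∙-insertAt (M zero) x p y ⟩
      M zero p * y + s                    ≡⟨ cong (_+ s) (pivot-term zero) ⟩
      - (M zero p * pivot⁻¹) * s + s      ≡⟨ cong (λ t → - t * s + s) (*-inverseʳ (M zero p) {{≢-nonZero pivot≢0}}) ⟩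
      - 1ℚ * s + s                        ≡⟨ cong (_+ s) (-1*x≈-x s) ⟩
      - s + s                             ≡⟨ +-inverseˡ s ⟩
      0ℚ                                  ∎
    solves (suc i) = begin
      M (suc i) ∙ x′                     ≡⟨ ∙-insertAt (M (suc i)) x p y ⟩
      M (suc i) p * y + t                ≡⟨ cong (_+ t) (pivot-term (suc i)) ⟩
      multiplier i * s + t               ≡⟨ +-comm (multiplier i * s) t ⟩
      t + multiplier i * s               ≡⟨ sym (∙-combinationˡ (removeAt (M (suc i)) p) (removeAt (M zero) p) x (multiplier i)) ⟩
      reduced i ∙ x                      ≡⟨ reduced·x≡0 i ⟩
      0ℚ                                 ∎
      where t = removeAt (M (suc i)) p ∙ x

underdetermined⇒nontrivialKernel : ∀ m (M : Fin m → Vector ℚ (suc m)) → NontrivialKernel M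
underdetermined⇒nontrivialKernel zero    M = (λ _ → 1ℚ) , (zero , 1≢0) , λ ()
underdetermined⇒nontrivialKernel (suc m) M with all? (λ j → M zero j ≟ 0ℚ)
... | yes row₀≡0 = nontrivialKernel-zero-firstRow M row₀≡0 (underdetermined⇒nontrivialKernel m (λ i j → M (suc i) (suc j)))
... | no  row₀≢0 with ¬∀⟶∃¬ _ _ (λ j → M zero j ≟ 0ℚ) row₀≢0
...   | p , pivot≢0 = nontrivialKernel-lift (underdetermined⇒nontrivialKernel m reduced)
  where open Elimination M p pivot≢0

RightInverse : ∀ {n} → Matrix n → Matrix n → Set
RightInverse A B = ∀ i j → (A ⊗ B) i j ≡ δ i j

∙-·-rightInverse : ∀ {n} (A B : Matrix n) → RightInverse A B → ∀ i v → A i ∙ (B · v) ≡ v i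
∙-·-rightInverse A B AB≡δ i v =
  trans (∙-·-⊗ A B i v) (trans (∙-congˡ v (AB≡δ i)) (δ-∙ i v))

-- A kernel vector (c, y) of the n × (n+1) matrix [x | B] gives c x + B y = 0;
-- applying A kills x and turns B into the identity, so y = 0, hence c ≠ 0 and x = 0.
rightInvertible⇒injective : ∀ {n} (A B : Matrix n) → RightInverse A B →
  ∀ x → (∀ i → (A · x) i ≡ 0ℚ) → ∀ i → x i ≡ 0ℚ
rightInvertible⇒injective {n} A B AB≡δ x Ax≡0 i
  with underdetermined⇒nontrivialKernel n (λ k → x k ∷ B k)
... | λs , (j , λj≢0) , kernel = x≡0 j λj≢0
  where
  c : ℚ
  c = λs zero
  y : Vector ℚ n
  y = λs ∘ suc

  By≡-cx : ∀ k → (B · y) k ≡ - c * x k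
  By≡-cx k = trans (inverseʳ-unique (x k * c) ((B · y) k) (kernel k))
                   (trans (cong -_ (*-comm (x k) c)) (neg-distribˡ-* c (x k)))

  y≡0 : ∀ l → y l ≡ 0ℚ
  y≡0 l = begin
    y l                      ≡⟨ sym (∙-·-rightInverse A B AB≡δ l y) ⟩
    A l ∙ (B · y)            ≡⟨ ∙-congʳ (A l) By≡-cx ⟩
    A l ∙ (λ k → - c * x k)  ≡⟨ ∙-scaleʳ (A l) x (- c) ⟩
    - c * (A l ∙ x)          ≡⟨ cong (- c *_) (Ax≡0 l) ⟩
    - c * 0ℚ                 ≡⟨ *-zeroʳ (- c) ⟩
    0ℚ                       ∎

  x≡0 : ∀ j → λs j ≢ 0ℚ → x i ≡ 0ℚ
  x≡0 zero    c≢0 = p*q≡0⇒p≡0 c≢0 (begin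
    x i * c                  ≡⟨ sym (+-identityʳ (x i * c)) ⟩
    x i * c + 0ℚ             ≡⟨ cong (x i * c +_) (sym (sum-zero (λ k → trans (cong (B i k *_) (y≡0 k)) (*-zeroʳ (B i k))))) ⟩
    x i * c + B i ∙ y        ≡⟨ kernel i ⟩
    0ℚ                       ∎)
  x≡0 (suc j) yj≢0 = ⊥-elim (yj≢0 (y≡0 j))

rightInverse⇒leftInverse : ∀ {n} (A B : Matrix n) → RightInverse A B → RightInverse B A
rightInverse⇒leftInverse A B AB≡δ i j =
  x∙y⁻¹≈ε⇒x≈y ((B ⊗ A) i j) (δ i j) (rightInvertible⇒injective A B AB≡δ x Ax≡0 i)
  where
  x : Vector ℚ _
  x k = (B ⊗ A) k j + - δ k j

  Ax≡0 : ∀ l → (A · x) l ≡ 0ℚ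
  Ax≡0 l = begin
    A l ∙ x                                              ≡⟨ ∙-distribˡ-+ (A l) (λ k → (B ⊗ A) k j) (λ k → - δ k j) ⟩
    A l ∙ (λ k → (B ⊗ A) k j) + A l ∙ (λ k → - δ k j)   ≡⟨ cong₂ _+_ (∙-congʳ (A l) (λ k → ⊗-∙ B A k j)) (∙-negʳ (A l) ((δ ᵀ) j)) ⟩
    A l ∙ (B · (A ᵀ) j) + - (A l ∙ (δ ᵀ) j)             ≡⟨ cong₂ (λ s t → s + - t) (∙-·-rightInverse A B AB≡δ l ((A ᵀ) j)) (∙-δ (A l) j) ⟩
    A l j + - A l j                                      ≡⟨ +-inverseʳ (A l j) ⟩
    0ℚ                                                   ∎

BlockTriangular : ∀ {n} → Pred (Fin n) 0ℓ → Matrix n → Set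
BlockTriangular P A = ∀ x y → P x → ¬ P y → A x y ≡ 0ℚ

module _ {n} {P : Pred (Fin n) 0ℓ} (P? : Decidable P) where

  -- The P × P block of M, kept in Matrix n by padding with the identity.
  diagonalBlock : Matrix n → Matrix n
  diagonalBlock M x y with P? x | P? y
  ... | yes _ | yes _ = M x y
  ... | _     | _     = δ x y

  δ-across : ∀ x y → P x → ¬ P y → δ x y ≡ 0ℚ
  δ-across x y px ¬py = δ-≢ x y λ { refl → ¬py px }

  diagonalBlock-inside : ∀ M x y → P x → P y → diagonalBlock M x y ≡ M x y
  diagonalBlock-inside M x y px py with P? x | P? y
  ... | yes _  | yes _  = refl
  ... | no ¬px | _      = ⊥-elim (¬px px)
  ... | yes _  | no ¬py = ⊥-elim (¬py py)

  diagonalBlock-outsideˡ : ∀ M x y → ¬ P x → diagonalBlock M x y ≡ δ x y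
  diagonalBlock-outsideˡ M x y ¬px with P? x
  ... | yes px = ⊥-elim (¬px px)
  ... | no _   = refl

  diagonalBlock-outsideʳ : ∀ M x y → ¬ P y → diagonalBlock M x y ≡ δ x y
  diagonalBlock-outsideʳ M x y ¬py with P? x | P? y
  ... | _     | yes py = ⊥-elim (¬py py)
  ... | yes _ | no _   = refl
  ... | no _  | no _   = refl

  diagonalBlock-row : ∀ M → BlockTriangular P M → ∀ x → P x → diagonalBlock M x ≗ M x
  diagonalBlock-row M triangular x px y = case P? y of λ where
    (yes py) → diagonalBlock-inside M x y px py
    (no ¬py) → trans (diagonalBlock-outsideʳ M x y ¬py)
                     (trans (δ-across x y px ¬py) (sym (triangular x y px ¬py)))

  diagonalBlock-rightInverse : ∀ A B → RightInverse A B → BlockTriangular P A →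
                               RightInverse (diagonalBlock A) (diagonalBlock B)
  diagonalBlock-rightInverse A B AB≡δ triangular x z = by-cases (P? x) (P? z)
    where
    A′ = diagonalBlock A
    B′ = diagonalBlock B

    row-term : P x → P z → ∀ y → A x y * B′ y z ≡ A x y * B y z
    row-term px pz y = case P? y of λ where
      (yes py) → cong (A x y *_) (diagonalBlock-inside B y z py pz)
      (no ¬py) → begin
        A x y * B′ y z  ≡⟨ cong (_* B′ y z) (triangular x y px ¬py) ⟩
        0ℚ * B′ y z     ≡⟨ *-zeroˡ (B′ y z) ⟩
        0ℚ              ≡⟨ sym (*-zeroˡ (B y z)) ⟩
        0ℚ * B y z      ≡⟨ cong (_* B y z) (sym (triangular x y px ¬py)) ⟩
        A x y * B y z   ∎

    by-cases : Dec (P x) → Dec (P z) → (A′ ⊗ B′) x z ≡ δ x z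
    by-cases (no ¬px) _ = begin
      (A′ ⊗ B′) x z     ≡⟨ ⊗-∙ A′ B′ x z ⟩
      A′ x ∙ (B′ ᵀ) z   ≡⟨ ∙-congˡ ((B′ ᵀ) z) (λ y → diagonalBlock-outsideˡ A x y ¬px) ⟩
      δ x ∙ (B′ ᵀ) z    ≡⟨ δ-∙ x ((B′ ᵀ) z) ⟩
      B′ x z            ≡⟨ diagonalBlock-outsideˡ B x z ¬px ⟩
      δ x z             ∎
    by-cases (yes _) (no ¬pz) = begin
      (A′ ⊗ B′) x z     ≡⟨ ⊗-∙ A′ B′ x z ⟩
      A′ x ∙ (B′ ᵀ) z   ≡⟨ ∙-congʳ (A′ x) (λ y → diagonalBlock-outsideʳ B y z ¬pz) ⟩
      A′ x ∙ (δ ᵀ) z    ≡⟨ ∙-δ (A′ x) z ⟩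
      A′ x z            ≡⟨ diagonalBlock-outsideʳ A x z ¬pz ⟩
      δ x z             ∎
    by-cases (yes px) (yes pz) = begin
      (A′ ⊗ B′) x z     ≡⟨ ⊗-∙ A′ B′ x z ⟩
      A′ x ∙ (B′ ᵀ) z   ≡⟨ ∙-congˡ ((B′ ᵀ) z) (diagonalBlock-row A triangular x px) ⟩
      A x ∙ (B′ ᵀ) z    ≡⟨ sum-cong-≗ (row-term px pz) ⟩
      A x ∙ (B ᵀ) z     ≡⟨ sym (⊗-∙ A B x z) ⟩
      (A ⊗ B) x z       ≡⟨ AB≡δ x z ⟩
      δ x z             ∎

  -- B x y = Σ_l B′ x l (A′ Bᵀ) l y with B′ A′ = 1; for l ∈ P the inner factor
  -- is (A B) l y = 0, for l ∉ P the outer one is δ x l = 0.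
  rightInverse-blockTriangular : ∀ A B → RightInverse A B → BlockTriangular P A → BlockTriangular P B
  rightInverse-blockTriangular A B AB≡δ triangular x y px ¬py = begin
    B x y                          ≡⟨ sym (δ-∙ x ((B ᵀ) y)) ⟩
    δ x ∙ (B ᵀ) y                  ≡⟨ ∙-congˡ ((B ᵀ) y) (λ l → sym (B′A′≡δ x l)) ⟩
    (B′ ⊗ A′) x ∙ (B ᵀ) y          ≡⟨ sym (∙-·-⊗ B′ A′ x ((B ᵀ) y)) ⟩
    B′ x ∙ (A′ · (B ᵀ) y)          ≡⟨ sum-zero term ⟩
    0ℚ                             ∎
    where
    A′ = diagonalBlock A
    B′ = diagonalBlock B

    B′A′≡δ : RightInverse B′ A′
    B′A′≡δ = rightInverse⇒leftInverse A′ B′ (diagonalBlock-rightInverse A B AB≡δ triangular)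

    A′Bᵀ≡0 : ∀ l → P l → (A′ · (B ᵀ) y) l ≡ 0ℚ
    A′Bᵀ≡0 l pl = begin
      A′ l ∙ (B ᵀ) y   ≡⟨ ∙-congˡ ((B ᵀ) y) (diagonalBlock-row A triangular l pl) ⟩
      A l ∙ (B ᵀ) y    ≡⟨ sym (⊗-∙ A B l y) ⟩
      (A ⊗ B) l y      ≡⟨ AB≡δ l y ⟩
      δ l y            ≡⟨ δ-across l y pl ¬py ⟩
      0ℚ               ∎

    term : ∀ l → B′ x l * (A′ · (B ᵀ) y) l ≡ 0ℚ
    term l = case P? l of λ where
      (yes pl) → trans (cong (B′ x l *_) (A′Bᵀ≡0 l pl)) (*-zeroʳ (B′ x l))
      (no ¬pl) → trans (cong (_* (A′ · (B ᵀ) y) l) (trans (diagonalBlock-outsideʳ B x l ¬pl) (δ-across x l px ¬pl)))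
                       (*-zeroˡ ((A′ · (B ᵀ) y) l))

ℕ→ℚ≡0⇒≡0 : ∀ {k} → ℕ→ℚ k ≡ 0ℚ → k ≡ 0
ℕ→ℚ≡0⇒≡0 {k} eq = +-injective (begin
  ℤ.+ k                                 ≡⟨ sym (↥-/ (ℤ.+ k) 1) ⟩
  ↥ ℕ→ℚ k ℤ.* gcd (ℤ.+ k) (ℤ.+ 1)       ≡⟨ cong (λ q → ↥ q ℤ.* gcd (ℤ.+ k) (ℤ.+ 1)) eq ⟩
  ℤ.+ 0                                 ∎)

module _ (𝒜 : FiniteCategory) where
  open FiniteCategory 𝒜 using (hom) renaming (_∘_ to _∘ᶜ_)

  empty-hom-factor : ∀ {x y z} → hom x z ≡ 0 → Fin (hom y z) → hom x y ≡ 0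
  empty-hom-factor {x} {y} hxz≡0 g with hom x y in hxy
  ... | zero  = refl
  ... | suc _ = ⊥-elim (¬Fin0 (subst Fin hxz≡0 (g ∘ᶜ subst Fin (sym hxy) zero)))

  inhabited : ∀ {k} → k ≢ 0 → Fin k
  inhabited {zero}  k≢0 = ⊥-elim (k≢0 refl)
  inhabited {suc k} _   = zero

  ζ-blockTriangular : ∀ b → BlockTriangular (λ x → hom x b ≡ 0) (ζ 𝒜)
  ζ-blockTriangular b x y hxb≡0 hyb≢0 = cong ℕ→ℚ (empty-hom-factor hxb≡0 (inhabited hyb≢0))

corollary3p1 : (𝒜 : FiniteCategory) (μ : Matrix (FiniteCategory.nObj 𝒜)) →
    IsInverse (ζ 𝒜) μ →
    ∀ (a b : Fin (FiniteCategory.nObj 𝒜)) → ζ 𝒜 a b ≡ 0ℚ → μ a b ≡ 0ℚ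
corollary3p1 𝒜 μ (ζμ≡δ , _) a b ζab≡0 =
  rightInverse-blockTriangular (λ x → hom x b ℕ.≟ 0) (ζ 𝒜) μ ζμ≡δ (ζ-blockTriangular 𝒜 b) a b hab≡0 hbb≢0
  where
  open FiniteCategory 𝒜 using (hom; idm)
  hab≡0 : hom a b ≡ 0
  hab≡0 = ℕ→ℚ≡0⇒≡0 ζab≡0
  hbb≢0 : hom b b ≢ 0
  hbb≢0 hbb≡0 = ¬Fin0 (subst Fin hbb≡0 (idm b))
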